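{- Let $\mathcal{M}$ be a model of $T^I_\triangleright$, let $\varphi(x,\vec y)$ be an atomic $L_\triangleright$ formula not containing the symbol $p$, and let $\vec b$ be a tuple of elements of $\mathcal{M}$. Then either $\varphi(x,\vec b)$ is valid in $\mathcal{M}$ (i.e. $\mathcal{M}\models\varphi(a,\vec b)$ for all $a\in\mathcal{M}$), or every set of pairwise comparable solutions of $\varphi(x,\vec b)$ in $\mathcal{M}$ is finite (a solution being an $a\in\mathcal{M}$ with $\mathcal{M}\models\varphi(a,\vec b)$).
   Context: $L_\triangleright$ is the one-sorted first-order language with function symbols $0$ (constant), $s$, $p$ (unary), $+$ (binary, infix) and a binary predicate symbol $\triangleright$ (infix). $T^I_\triangleright$ is the theory with axioms (A1) $\forall x\, sx\neq 0$; (A2) $p0=0$; (A3) $\forall x\, p\,sx=x$; (A4) $\forall x\, x+0=x$; (A5) $\forall x\forall y\, x+sy=s(x+y)$; (A6) $0\triangleright 0$; (A7) $\forall x\forall y\,(x\triangleright y\to sx\triangleright (sx+y))$; (A8) $\forall x\forall y\,(sx\triangleright(sx+y)\to x\triangleright y)$; (A9) $\forall x\forall y\forall z\,(x\triangleright y\wedge x\triangleright z\to y=z)$; (B1) $\forall x\,(x\neq0\to x=s\,p\,x)$; (B2) $\forall x\forall y\, x+y=y+x$; (B3) $\forall x\forall y\forall z\,(x+y)+z=x+(y+z)$; (B4) $\forall x\forall y\forall z\,(x+y=x+z\to y=z)$. Writing $\mathbf{S}$ for the interpretation of $s$ in $\mathcal{M}$, for $a,b\in\mathcal{M}$ define $a\prec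 b$ if $\mathbf{S}^n a=b$ for some $n\ge1$, $a\preceq b$ if $a\prec b$ or $a=b$, and call $a,b$ comparable if $a\preceq b$ or $b\preceq a$. -}

module Defs where

open import Data.Nat using (ℕ; zero; suc; _≥_)
open import Data.Fin using (Fin)
open import Data.Product using (Σ; ∃; _×_)
open import Data.Sum using (_⊎_)
open import Data.Empty using (⊥)
open import Data.List using (List)
open import Data.List.Membership.Propositional using (_∈_)
open import Relation.Nullary using (¬_)
open import Relation.Binary.PropositionalEquality using (_≡_)
open import Function using (_∘_)

-- An L_▷-structure (equality is interpreted as propositional equality).
record Structure : Set₁ where
  field
    Carrier : Set
    𝟘   : Carrier
    S   : Carrier → Carrier
    P   : Carrier → Carrier
    _⊕_ : Carrier → Carrier → Carrier
    _▷_ : Carrier → Carrier → Set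

record IsModel (M : Structure) : Set where
  open Structure M
  field
    A1 : ∀ x → ¬ (S x ≡ 𝟘)
    A2 : P 𝟘 ≡ 𝟘
    A3 : ∀ x → P (S x) ≡ x
    A4 : ∀ x → (x ⊕ 𝟘) ≡ x
    A5 : ∀ x y → (x ⊕ S y) ≡ S (x ⊕ y)
    A6 : 𝟘 ▷ 𝟘
    A7 : ∀ x y → x ▷ y → S x ▷ (S x ⊕ y)
    A8 : ∀ x y → S x ▷ (S x ⊕ y) → x ▷ y
    A9 : ∀ x y z → x ▷ y → x ▷ z → y ≡ z
    B1 : ∀ x → ¬ (x ≡ 𝟘) → x ≡ S (P x)
    B2 : ∀ x y → (x ⊕ y) ≡ (y ⊕ x)
    B3 : ∀ x y z → ((x ⊕ y) ⊕ z) ≡ (x ⊕ (y ⊕ z))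
    B4 : ∀ x y z → (x ⊕ y) ≡ (x ⊕ z) → y ≡ z

-- L_▷-terms NOT containing p, in the variables x (varX) and y₁..yₙ (varY i).
data Term (n : ℕ) : Set where
  varX : Term n
  varY : Fin n → Term n
  zeroT : Term n
  sT   : Term n → Term n
  _+T_ : Term n → Term n → Term n

data Atomic (n : ℕ) : Set where
  _≐_ : Term n → Term n → Atomic n
  _▷T_ : Term n → Term n → Atomic n

module _ (M : Structure) where
  open Structure M

  evalT : ∀ {n} → Term n → Carrier → (Fin n → Carrier) → Carrier
  evalT varX a b = a
  evalT (varY i) a b = b i
  evalT zeroT a b = 𝟘
  evalT (sT t) a b = S (evalT t a b)
  evalT (t +T u) a b = evalT t a b ⊕ evalT u a b

  Sat : ∀ {n} → Atomic n → Carrier → (Fin n → Carrier) → Set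
  Sat (t ≐ u) a b = evalT t a b ≡ evalT u a b
  Sat (t ▷T u) a b = evalT t a b ▷ evalT u a b

  iterS : ℕ → Carrier → Carrier
  iterS zero a = a
  iterS (suc k) a = S (iterS k a)

  _≺_ : Carrier → Carrier → Set
  a ≺ b = Σ ℕ (λ k → k ≥ 1 × iterS k a ≡ b)

  _≼_ : Carrier → Carrier → Set
  a ≼ b = a ≺ b ⊎ a ≡ b

  Comparable : Carrier → Carrier → Set
  Comparable a b = a ≼ b ⊎ b ≼ a

  FiniteSet : (Carrier → Set) → Set
  FiniteSet X = Σ (List Carrier) (λ l → ∀ a → X a → a ∈ l)

-- A term without p is linear in x: it evaluates to c·x ⊕ (constant), so replacing x by S^j x
-- replaces the term's value v by S^(c j) v. An equation satisfied by two solutions a and S^j a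
-- (j ≥ 1) therefore has equal coefficients on both sides, and then it holds everywhere or nowhere.
-- For t ▷ u with c_t ≥ 1, iterating A7 m times turns t(a) ▷ u(a) into
-- S^m t(a) ▷ S^(m(m+1)/2) (z ⊕ u(a)); for m = c_t j this must agree by A9 with the linear shift
-- S^(c_u j) u(a), which is impossible once j > 2 c_u. So in every non-valid case solutions lie at
-- bounded distance, and a set of pairwise comparable solutions lies in a finite window around any
-- one of its elements.
module Submission where

open import Defs
open import Data.Nat using (ℕ; zero; suc; _+_; _*_; _≤_; _<_; z≤n; s≤s; _≤?_; _≟_)
open import Data.Nat.Properties
open import Data.Nat.Solver using (module +-*-Solver)
open import Data.Fin using (Fin)
open import Data.Sum using (_⊎_; inj₁; inj₂)
open import Data.Product using (∃; _,_)
open import Data.Empty using (⊥-elim)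
open import Data.List using (List; []; applyUpTo; _++_)
open import Data.List.Membership.Propositional using (_∈_)
open import Data.List.Membership.Propositional.Properties using (∈-applyUpTo⁺; ∈-++⁺ˡ; ∈-++⁺ʳ)
open import Function using (_∘′_; _⇔_; mk⇔; Equivalence)
open import Relation.Nullary using (¬_; yes; no)
open import Relation.Binary.PropositionalEquality
open import Level using (0ℓ)
open import Axiom.ExcludedMiddle using (ExcludedMiddle)

triangle : ℕ → ℕ
triangle zero    = 0
triangle (suc m) = suc m + triangle m

triangle-double : ∀ m → triangle m + triangle m ≡ m * suc m
triangle-double zero    = refl
triangle-double (suc m) = begin
  (suc m + t) + (suc m + t)    ≡⟨ solve 2 (λ m t → (con 1 :+ m :+ t) :+ (con 1 :+ m :+ t)
                                               := (con 2 :+ m :+ m) :+ (t :+ t)) refl m t ⟩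
  (2 + m + m) + (t + t)        ≡⟨ cong ((2 + m + m) +_) (triangle-double m) ⟩
  (2 + m + m) + m * suc m      ≡⟨ solve 1 (λ m → (con 2 :+ m :+ m) :+ m :* (con 1 :+ m)
                                               := (con 1 :+ m) :* (con 2 :+ m)) refl m ⟩
  suc m * suc (suc m)          ∎
  where
  open ≡-Reasoning
  open +-*-Solver
  t = triangle m

triangle-mono-≤ : ∀ {m n} → m ≤ n → triangle m ≤ triangle n
triangle-mono-≤ {zero}  _         = z≤n
triangle-mono-≤ {suc m} (s≤s m≤n) = +-mono-≤ (s≤s m≤n) (triangle-mono-≤ m≤n)

*-<-triangle : ∀ k j → 2 * k < j → k * j < triangle j
*-<-triangle k j@(suc _) 2k<j = *-cancelˡ-< 2 (k * j) (triangle j) (begin-strict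
  2 * (k * j)              ≡⟨ *-assoc 2 k j ⟨
  (2 * k) * j              <⟨ *-monoˡ-< j (n<1+n (2 * k)) ⟩
  suc (2 * k) * j          ≤⟨ *-monoˡ-≤ j 2k<j ⟩
  j * j                    ≤⟨ *-monoʳ-≤ j (n≤1+n j) ⟩
  j * suc j                ≡⟨ triangle-double j ⟨
  triangle j + triangle j  ≡⟨ cong (triangle j +_) (+-identityʳ (triangle j)) ⟨
  2 * triangle j           ∎)
  where open ≤-Reasoning

*-<-triangle-* : ∀ c k j → 1 ≤ c → 2 * k < j → k * j < triangle (c * j)
*-<-triangle-* (suc c) k j _ 2k<j =
  <-≤-trans (*-<-triangle k j 2k<j) (triangle-mono-≤ (m≤n*m j (suc c)))

xCoeff : ∀ {n} → Term n → ℕ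
xCoeff varX     = 1
xCoeff (varY _) = 0
xCoeff zeroT    = 0
xCoeff (sT t)   = xCoeff t
xCoeff (t +T u) = xCoeff t + xCoeff u

module _ (M : Structure) where
  open Structure M

  times : ℕ → Carrier → Carrier
  times zero    a = 𝟘
  times (suc k) a = a ⊕ times k a

  iterP : ℕ → Carrier → Carrier
  iterP zero    a = a
  iterP (suc k) a = iterP k (P a)

  window : Carrier → ℕ → List Carrier
  window a B = applyUpTo (λ k → iterS M k a) (suc B) ++ applyUpTo (λ k → iterP k a) (suc B)

  GapBounded : (Carrier → Set) → ℕ → Set
  GapBounded Q B = ∀ a j → Q a → Q (iterS M j a) → j ≤ B

  Solution : ∀ {n} → Atomic n → (Fin n → Carrier) → Carrier → Set
  Solution φ b a = Sat M φ a b

  ≼⇒iterS : ∀ {a a′} → _≼_ M a a′ → ∃ λ k → iterS M k a ≡ a′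
  ≼⇒iterS (inj₁ (k , _ , eq)) = k , eq
  ≼⇒iterS (inj₂ eq)           = 0 , eq

  empty-gapBounded : ∀ {Q : Carrier → Set} → (∀ a → ¬ Q a) → GapBounded Q 0
  empty-gapBounded ¬Q a _ Qa _ = ⊥-elim (¬Q a Qa)

  constant-dichotomy : ExcludedMiddle 0ℓ → ∀ {Q : Carrier → Set} {C : Set} →
                       (∀ a → Q a ⇔ C) → (∀ a → Q a) ⊎ ∃ (GapBounded Q)
  constant-dichotomy em Q⇔C with em
  ... | yes c  = inj₁ λ a → Equivalence.from (Q⇔C a) c
  ... | no ¬c = inj₂ (0 , empty-gapBounded λ a Qa → ¬c (Equivalence.to (Q⇔C a) Qa))

  module _ (isModel : IsModel M) where
    open IsModel isModel

    S-injective : ∀ {x y} → S x ≡ S y → x ≡ y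
    S-injective {x} {y} eq = trans (sym (A3 x)) (trans (cong P eq) (A3 y))

    ⊕-identityˡ : ∀ x → 𝟘 ⊕ x ≡ x
    ⊕-identityˡ x = trans (B2 𝟘 x) (A4 x)

    ⊕-interchange : ∀ w x y z → (w ⊕ x) ⊕ (y ⊕ z) ≡ (w ⊕ y) ⊕ (x ⊕ z)
    ⊕-interchange w x y z = begin
      (w ⊕ x) ⊕ (y ⊕ z)  ≡⟨ B3 w x (y ⊕ z) ⟩
      w ⊕ (x ⊕ (y ⊕ z))  ≡⟨ cong (w ⊕_) (B3 x y z) ⟨
      w ⊕ ((x ⊕ y) ⊕ z)  ≡⟨ cong (λ v → w ⊕ (v ⊕ z)) (B2 x y) ⟩
      w ⊕ ((y ⊕ x) ⊕ z)  ≡⟨ cong (w ⊕_) (B3 y x z) ⟩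
      w ⊕ (y ⊕ (x ⊕ z))  ≡⟨ B3 w y (x ⊕ z) ⟨
      (w ⊕ y) ⊕ (x ⊕ z)  ∎
      where open ≡-Reasoning

    iterS-+ : ∀ m n x → iterS M m (iterS M n x) ≡ iterS M (m + n) x
    iterS-+ zero    n x = refl
    iterS-+ (suc m) n x = cong S (iterS-+ m n x)

    iterS-S : ∀ n x → S (iterS M n x) ≡ iterS M n (S x)
    iterS-S zero    x = refl
    iterS-S (suc n) x = cong S (iterS-S n x)

    ⊕-iterS : ∀ n x y → x ⊕ iterS M n y ≡ iterS M n (x ⊕ y)
    ⊕-iterS zero    x y = refl
    ⊕-iterS (suc n) x y = trans (A5 x (iterS M n y)) (cong S (⊕-iterS n x y))

    iterS-⊕ : ∀ n x y → iterS M n x ⊕ y ≡ iterS M n (x ⊕ y)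
    iterS-⊕ n x y = trans (B2 (iterS M n x) y) (trans (⊕-iterS n y x) (cong (iterS M n) (B2 y x)))

    iterS-suc-⊕-≢ : ∀ d z v → iterS M (suc d) (z ⊕ v) ≢ v
    iterS-suc-⊕-≢ d z v eq = A1 (iterS M d z) (B4 v (iterS M (suc d) z) 𝟘 (begin
      v ⊕ iterS M (suc d) z  ≡⟨ ⊕-iterS (suc d) v z ⟩
      iterS M (suc d) (v ⊕ z)  ≡⟨ cong (iterS M (suc d)) (B2 v z) ⟩
      iterS M (suc d) (z ⊕ v)  ≡⟨ eq ⟩
      v                        ≡⟨ A4 v ⟨
      v ⊕ 𝟘                    ∎))
      where open ≡-Reasoning

    iterS-suc-≢ : ∀ d v → iterS M (suc d) v ≢ v
    iterS-suc-≢ d v eq = iterS-suc-⊕-≢ d 𝟘 v (trans (cong (iterS M (suc d)) (⊕-identityˡ v)) eq)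

    iterS-injectiveˡ : ∀ m n x → iterS M m x ≡ iterS M n x → m ≡ n
    iterS-injectiveˡ zero    zero    x eq = refl
    iterS-injectiveˡ (suc m) zero    x eq = ⊥-elim (iterS-suc-≢ m x eq)
    iterS-injectiveˡ zero    (suc n) x eq = ⊥-elim (iterS-suc-≢ n x (sym eq))
    iterS-injectiveˡ (suc m) (suc n) x eq = cong suc (iterS-injectiveˡ m n x (S-injective eq))

    iterS-<-≢ : ∀ {m n} z v → m < n → iterS M n (z ⊕ v) ≢ iterS M m v
    iterS-<-≢ {zero}  {suc d} z v _         = iterS-suc-⊕-≢ d z v
    iterS-<-≢ {suc m} {suc n} z v (s≤s m<n) = iterS-<-≢ z v m<n ∘′ S-injective

    times-+ : ∀ m n a → times (m + n) a ≡ times m a ⊕ times n a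
    times-+ zero    n a = sym (⊕-identityˡ (times n a))
    times-+ (suc m) n a = trans (cong (a ⊕_) (times-+ m n a)) (sym (B3 a (times m a) (times n a)))

    evalT-linear : ∀ {n} (t : Term n) a b → evalT M t a b ≡ times (xCoeff t) a ⊕ evalT M t 𝟘 b
    evalT-linear varX     a b = sym (trans (A4 _) (A4 a))
    evalT-linear (varY i) a b = sym (⊕-identityˡ (b i))
    evalT-linear zeroT    a b = sym (A4 𝟘)
    evalT-linear (sT t)   a b = trans (cong S (evalT-linear t a b)) (sym (A5 _ _))
    evalT-linear (t +T u) a b =
      trans (cong₂ _⊕_ (evalT-linear t a b) (evalT-linear u a b))
            (trans (⊕-interchange _ _ _ _) (cong (_⊕ _) (sym (times-+ (xCoeff t) (xCoeff u) a))))

    evalT-constant : ∀ {n} (t : Term n) a b → xCoeff t ≡ 0 → evalT M t a b ≡ evalT M t 𝟘 b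
    evalT-constant t a b c≡0 =
      trans (evalT-linear t a b) (trans (cong (λ k → times k a ⊕ evalT M t 𝟘 b) c≡0) (⊕-identityˡ _))

    evalT-iterS : ∀ {n} (t : Term n) j a b →
                  evalT M t (iterS M j a) b ≡ iterS M (xCoeff t * j) (evalT M t a b)
    evalT-iterS varX     j a b = cong (λ k → iterS M k a) (sym (*-identityˡ j))
    evalT-iterS (varY i) j a b = refl
    evalT-iterS zeroT    j a b = refl
    evalT-iterS (sT t)   j a b = trans (cong S (evalT-iterS t j a b)) (iterS-S (xCoeff t * j) (evalT M t a b))
    evalT-iterS (t +T u) j a b = begin
      evalT M t (iterS M j a) b ⊕ evalT M u (iterS M j a) b
        ≡⟨ cong₂ _⊕_ (evalT-iterS t j a b) (evalT-iterS u j a b) ⟩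
      iterS M (ct * j) x ⊕ iterS M (cu * j) y
        ≡⟨ iterS-⊕ (ct * j) x _ ⟩
      iterS M (ct * j) (x ⊕ iterS M (cu * j) y)
        ≡⟨ cong (iterS M (ct * j)) (⊕-iterS (cu * j) x y) ⟩
      iterS M (ct * j) (iterS M (cu * j) (x ⊕ y))
        ≡⟨ iterS-+ (ct * j) (cu * j) (x ⊕ y) ⟩
      iterS M (ct * j + cu * j) (x ⊕ y)
        ≡⟨ cong (λ k → iterS M k (x ⊕ y)) (*-distribʳ-+ j ct cu) ⟨
      iterS M ((ct + cu) * j) (x ⊕ y)
        ∎
      where
      open ≡-Reasoning
      ct = xCoeff t
      cu = xCoeff u
      x = evalT M t a b
      y = evalT M u a b

    ▷-iterS : ∀ {u v} → u ▷ v → ∀ m → iterS M m u ▷ iterS M (triangle m) (times m u ⊕ v)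
    ▷-iterS {u} {v} u▷v zero    = subst (u ▷_) (sym (⊕-identityˡ v)) u▷v
    ▷-iterS {u} {v} u▷v (suc m) = subst (S (iterS M m u) ▷_) eq (A7 _ _ (▷-iterS u▷v m))
      where
      open ≡-Reasoning
      eq : S (iterS M m u) ⊕ iterS M (triangle m) (times m u ⊕ v)
           ≡ iterS M (triangle (suc m)) (times (suc m) u ⊕ v)
      eq = begin
        iterS M (suc m) u ⊕ iterS M (triangle m) (times m u ⊕ v)
          ≡⟨ iterS-⊕ (suc m) u _ ⟩
        iterS M (suc m) (u ⊕ iterS M (triangle m) (times m u ⊕ v))
          ≡⟨ cong (iterS M (suc m)) (⊕-iterS (triangle m) u _) ⟩
        iterS M (suc m) (iterS M (triangle m) (u ⊕ (times m u ⊕ v)))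
          ≡⟨ iterS-+ (suc m) (triangle m) _ ⟩
        iterS M (triangle (suc m)) (u ⊕ (times m u ⊕ v))
          ≡⟨ cong (iterS M (triangle (suc m))) (B3 u (times m u) v) ⟨
        iterS M (triangle (suc m)) ((u ⊕ times m u) ⊕ v)
          ∎

    comparable-gapBounded-finite :
      ExcludedMiddle 0ℓ → ∀ {Q X : Carrier → Set} {B} → GapBounded Q B →
      (∀ a → X a → Q a) → (∀ a a′ → X a → X a′ → Comparable M a a′) → FiniteSet M X
    comparable-gapBounded-finite em {Q} {X} {B} bounded X⊆Q comparable with em {∃ X}
    ... | no ∄X = [] , λ a Xa → ⊥-elim (∄X (a , Xa))
    ... | yes (a₀ , Xa₀) = window a₀ B , member
      where
      ahead : ∀ {k} → k ≤ B → iterS M k a₀ ∈ window a₀ B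
      ahead k≤B = ∈-++⁺ˡ (∈-applyUpTo⁺ (λ k → iterS M k a₀) (s≤s k≤B))

      behind : ∀ {k} → k ≤ B → iterP k a₀ ∈ window a₀ B
      behind k≤B = ∈-++⁺ʳ (applyUpTo (λ k → iterS M k a₀) (suc B)) (∈-applyUpTo⁺ (λ k → iterP k a₀) (s≤s k≤B))

      iterP-iterS : ∀ k a → iterP k (iterS M k a) ≡ a
      iterP-iterS zero    a = refl
      iterP-iterS (suc k) a = trans (cong (iterP k) (A3 (iterS M k a))) (iterP-iterS k a)

      member : ∀ a → X a → a ∈ window a₀ B
      member a Xa with comparable a₀ a Xa₀ Xa
      ... | inj₁ a₀≼a with k , eq ← ≼⇒iterS a₀≼a =
        subst (_∈ window a₀ B) eq
          (ahead (bounded a₀ k (X⊆Q a₀ Xa₀) (subst Q (sym eq) (X⊆Q a Xa))))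
      ... | inj₂ a≼a₀ with k , eq ← ≼⇒iterS a≼a₀ =
        subst (_∈ window a₀ B) (trans (cong (iterP k) (sym eq)) (iterP-iterS k a))
          (behind (bounded a k (X⊆Q a Xa) (subst Q (sym eq) (X⊆Q a₀ Xa₀))))

    module _ {n} (t u : Term n) (b : Fin n → Carrier) where

      ≐-solution⇔ : xCoeff t ≡ xCoeff u → ∀ a → Solution (t ≐ u) b a ⇔ (evalT M t 𝟘 b ≡ evalT M u 𝟘 b)
      ≐-solution⇔ ct≡cu a = mk⇔
        (λ sol → B4 (times (xCoeff u) a) _ _ (begin
          times (xCoeff u) a ⊕ evalT M t 𝟘 b  ≡⟨ cong (λ k → times k a ⊕ _) ct≡cu ⟨
          times (xCoeff t) a ⊕ evalT M t 𝟘 b  ≡⟨ evalT-linear t a b ⟨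
          evalT M t a b                       ≡⟨ sol ⟩
          evalT M u a b                       ≡⟨ evalT-linear u a b ⟩
          times (xCoeff u) a ⊕ evalT M u 𝟘 b  ∎))
        (λ c → begin
          evalT M t a b                       ≡⟨ evalT-linear t a b ⟩
          times (xCoeff t) a ⊕ evalT M t 𝟘 b  ≡⟨ cong₂ (λ k w → times k a ⊕ w) ct≡cu c ⟩
          times (xCoeff u) a ⊕ evalT M u 𝟘 b  ≡⟨ evalT-linear u a b ⟨
          evalT M u a b                       ∎)
        where open ≡-Reasoning

      ≐-gapBounded : xCoeff t ≢ xCoeff u → GapBounded (Solution (t ≐ u) b) 0
      ≐-gapBounded ct≢cu a zero    _   _    = z≤n
      ≐-gapBounded ct≢cu a j@(suc _) sol sol′ =
        ⊥-elim (ct≢cu (*-cancelʳ-≡ (xCoeff t) (xCoeff u) j (iterS-injectiveˡ _ _ (evalT M t a b) (begin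
          iterS M (xCoeff t * j) (evalT M t a b)  ≡⟨ evalT-iterS t j a b ⟨
          evalT M t (iterS M j a) b               ≡⟨ sol′ ⟩
          evalT M u (iterS M j a) b               ≡⟨ evalT-iterS u j a b ⟩
          iterS M (xCoeff u * j) (evalT M u a b)  ≡⟨ cong (iterS M (xCoeff u * j)) sol ⟨
          iterS M (xCoeff u * j) (evalT M t a b)  ∎))))
        where open ≡-Reasoning

      ▷-solution⇔ : xCoeff t ≡ 0 → xCoeff u ≡ 0 → ∀ a → Solution (t ▷T u) b a ⇔ (evalT M t 𝟘 b ▷ evalT M u 𝟘 b)
      ▷-solution⇔ ct≡0 cu≡0 a = mk⇔
        (subst₂ _▷_ (evalT-constant t a b ct≡0) (evalT-constant u a b cu≡0))
        (subst₂ _▷_ (sym (evalT-constant t a b ct≡0)) (sym (evalT-constant u a b cu≡0)))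

      ▷-iterS-solution : ∀ a j → Solution (t ▷T u) b (iterS M j a) →
                         iterS M (xCoeff t * j) (evalT M t a b) ▷ iterS M (xCoeff u * j) (evalT M u a b)
      ▷-iterS-solution a j = subst₂ _▷_ (evalT-iterS t j a b) (evalT-iterS u j a b)

      ▷-gapBounded-constantˡ : ∀ {k} → xCoeff t ≡ 0 → xCoeff u ≡ suc k → GapBounded (Solution (t ▷T u) b) 0
      ▷-gapBounded-constantˡ ct≡0 cu≡1+k a zero      _   _    = z≤n
      ▷-gapBounded-constantˡ {k} ct≡0 cu≡1+k a j@(suc i) sol sol′ =
        ⊥-elim (iterS-suc-≢ (i + k * j) (evalT M u a b) (sym (A9 _ _ _ sol shifted)))
        where
        shifted : evalT M t a b ▷ iterS M (suc k * j) (evalT M u a b)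
        shifted = subst₂ (λ c d → iterS M (c * j) (evalT M t a b) ▷ iterS M (d * j) (evalT M u a b))
                         ct≡0 cu≡1+k (▷-iterS-solution a j sol′)

      ▷-gapBounded : 1 ≤ xCoeff t → GapBounded (Solution (t ▷T u) b) (2 * xCoeff u)
      ▷-gapBounded 1≤ct a j sol sol′ with j ≤? 2 * xCoeff u
      ... | yes j≤2cu = j≤2cu
      ... | no  j≰2cu = ⊥-elim (iterS-<-≢ (times (xCoeff t * j) (evalT M t a b)) (evalT M u a b)
              (*-<-triangle-* (xCoeff t) (xCoeff u) j 1≤ct (≰⇒> j≰2cu))
              (A9 _ _ _ (▷-iterS sol (xCoeff t * j)) (▷-iterS-solution a j sol′)))

    dichotomy : ExcludedMiddle 0ℓ → ∀ {n} (φ : Atomic n) b →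
                (∀ a → Sat M φ a b) ⊎ ∃ (GapBounded (Solution φ b))
    dichotomy em (t ≐ u) b with xCoeff t ≟ xCoeff u
    ... | yes ct≡cu = constant-dichotomy em (≐-solution⇔ t u b ct≡cu)
    ... | no  ct≢cu = inj₂ (0 , ≐-gapBounded t u b ct≢cu)
    dichotomy em (t ▷T u) b with xCoeff t in ct | xCoeff u in cu
    ... | zero  | zero  = constant-dichotomy em (▷-solution⇔ t u b ct cu)
    ... | zero  | suc _ = inj₂ (0 , ▷-gapBounded-constantˡ t u b ct cu)
    ... | suc _ | _     = inj₂ (2 * xCoeff u , ▷-gapBounded t u b (subst (1 ≤_) (sym ct) (s≤s z≤n)))

proposition3p9 : ExcludedMiddle 0ℓ →
    (M : Structure) → IsModel M →
    {n : ℕ} (φ : Atomic n) (b : Fin n → Structure.Carrier M) →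
    (∀ a → Sat M φ a b)
    ⊎ ((X : Structure.Carrier M → Set) →
       (∀ a → X a → Sat M φ a b) →
       (∀ a a′ → X a → X a′ → Comparable M a a′) →
       FiniteSet M X)
proposition3p9 em M isModel φ b with dichotomy M isModel em φ b
... | inj₁ valid          = inj₁ valid
... | inj₂ (B , bounded) = inj₂ λ X X⊆solutions comparable →
  comparable-gapBounded-finite M isModel em bounded X⊆solutions comparable
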